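{- Suppose that $B$ is an $r\times r$ matrix with entries in $\{ -1,+1\}$ and $C$ is a $t\times t$ matrix with entries in $\{ -1,+1\}$, and that the tensor product $H=B\otimes C$ is a Hadamard matrix. Then $B$ and $C$ are Hadamard matrices. If $H$ is symmetric then so are $B$ and $C$. If $H$ and $B$ are normalised and $H$ satisfies (EGC), then $B$ and $C$ satisfy (EGC) and $C$ is normalised.
   Context: A Hadamard matrix is a square matrix with entries in $\{ -1,1\}$ such that $HH^T$ is diagonal. It is normalised if its first row and first column consist entirely of $+1$'s. The tensor (Kronecker) product of an $r\times s$ matrix $B$ and a $t\times u$ matrix $C$ is the $rt\times su$ matrix with $(B\otimes C)_{(k-1)t+i,(\ell-1)u+j}=B_{k,\ell}C_{i,j}$. The Hadamard product $A\circ B$ is the entrywise product. For an $n\times n$ matrix $H$ with rows $H_{1,*},\dots,H_{n,*}$ let $R(H)=\{H_{i,*}\mid i\in[n]\}$. $H$ satisfies the Extended Group Condition (EGC) if $R(H)$ is an Abelian group under the Hadamard product. -}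

module Defs where

open import Data.Nat using (ℕ; zero; suc) renaming (_*_ to _*ℕ_)
open import Data.Fin using (Fin; zero; suc; toℕ; quotient; remainder)
open import Data.Integer using (ℤ; +_; -[1+_]; _+_; _*_)
open import Data.Product using (_×_; ∃)
open import Data.Sum using (_⊎_)
open import Relation.Binary.PropositionalEquality using (_≡_; _≢_)

-- square n×n integer matrices, as functions of (row, column)
Mat : ℕ → Set
Mat n = Fin n → Fin n → ℤ

Row : ℕ → Set
Row n = Fin n → ℤ

Σ[_] : (n : ℕ) → (Fin n → ℤ) → ℤ
Σ[ zero ] f = + 0
Σ[ suc n ] f = f zero + Σ[ n ] (λ i → f (suc i))

PM : ∀ {n} → Mat n → Set
PM {n} H = ∀ (i j : Fin n) → (H i j ≡ + 1) ⊎ (H i j ≡ -[1+ 0 ])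

HHᵀ-diagonal : ∀ {n} → Mat n → Set
HHᵀ-diagonal {n} H = ∀ (i j : Fin n) → i ≢ j → Σ[ n ] (λ k → H i k * H j k) ≡ + 0

Hadamard : ∀ {n} → Mat n → Set
Hadamard H = PM H × HHᵀ-diagonal H

Symmetric : ∀ {n} → Mat n → Set
Symmetric {n} H = ∀ (i j : Fin n) → H i j ≡ H j i

Normalised : ∀ {n} → Mat n → Set
Normalised {n} H = ∀ (i j : Fin n) → (toℕ i ≡ 0 → H i j ≡ + 1) × (toℕ j ≡ 0 → H i j ≡ + 1)

-- tensor (Kronecker) product: index (k-1)t+i  ↔  (k , i), via Data.Fin.combine/remQuot
_⊗_ : ∀ {r t} → Mat r → Mat t → Mat (r *ℕ t)
_⊗_ {r} {t} B C a b =
  B (quotient t a) (quotient t b) * C (remainder {r} t a) (remainder {r} t b)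

_∘ₕ_ : ∀ {n} → Row n → Row n → Row n
(u ∘ₕ v) k = u k * v k

_≈_ : ∀ {n} → Row n → Row n → Set
_≈_ {n} u v = ∀ (k : Fin n) → u k ≡ v k

_∈R_ : ∀ {n} → Row n → Mat n → Set
u ∈R H = ∃ λ i → u ≈ H i

-- Extended Group Condition: R(H) is an Abelian group under the Hadamard product
record EGC {n : ℕ} (H : Mat n) : Set where
  field
    closed   : ∀ (u v : Row n) → u ∈R H → v ∈R H → (u ∘ₕ v) ∈R H
    assoc    : ∀ (u v w : Row n) → u ∈R H → v ∈R H → w ∈R H →
               ((u ∘ₕ v) ∘ₕ w) ≈ (u ∘ₕ (v ∘ₕ w))
    comm     : ∀ (u v : Row n) → u ∈R H → v ∈R H → (u ∘ₕ v) ≈ (v ∘ₕ u)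
    e        : Row n
    e∈R      : e ∈R H
    identity : ∀ (u : Row n) → u ∈R H → ((e ∘ₕ u) ≈ u) × ((u ∘ₕ e) ≈ u)
    inverse  : ∀ (u : Row n) → u ∈R H →
               ∃ λ (v : Row n) → (v ∈R H) × ((u ∘ₕ v) ≈ e) × ((v ∘ₕ u) ≈ e)

module Submission where

-- Index the rows and columns of H = B ⊗ C by pairs via
-- Data.Fin.combine, so that  H (k,i) (l,j) = B k l * C i j.  Splitting a sum
-- over the columns of H along combine makes inner products multiplicative,
--   H (k,i) · H (k',i') = (B k · B k') * (C i · C i'),
-- while a ±1 row of length n has  u · u = n ≠ 0.  Orthogonality of the rows
-- (k,i₀), (k',i₀) of H therefore forces B k · B k' = 0, and likewise for C:
-- both factors are Hadamard.  Symmetry of B (resp. C) follows by cancelling a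
-- ±1 entry of C (resp. B) in  H (k,i₀) (l,i₀) = H (l,i₀) (k,i₀).  For (EGC): a
-- ±1 matrix with a row of +1's satisfies EGC as soon as its row set is closed
-- under the Hadamard product (that row is the identity and every row is its
-- own inverse), and closure descends from H to B (resp. C) along a column of
-- +1's in C (resp. B), which normalisation of B and H provides.

open import Defs
open import Data.Nat using (ℕ; _≤_; zero; suc) renaming (_*_ to _*ℕ_; _+_ to _+ℕ_)
open import Data.Product using (_×_; _,_; proj₁; proj₂)
open import Data.Sum using (_⊎_; inj₁; inj₂)
open import Data.Fin using (Fin; zero; suc; quotient; remainder; combine; _↑ˡ_; _↑ʳ_)
open import Data.Fin.Properties
  using (remQuot-combine; combine-injectiveˡ; combine-injectiveʳ; toℕ-↑ˡ)
open import Data.Integer using (ℤ; +_; -[1+_]; _+_; _*_)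
open import Data.Integer.Properties
  using ( *-identityˡ; *-identityʳ; *-assoc; *-comm; +-assoc; +-identityˡ
        ; *-distribˡ-+; *-zeroʳ; *-cancelʳ-≡; *-cancelˡ-≡; i*j≡0⇒i≡0∨j≡0)
open import Relation.Binary.PropositionalEquality
open import Data.Empty using (⊥-elim)
open ≡-Reasoning

Σ-cong : ∀ n {f g : Fin n → ℤ} → (∀ i → f i ≡ g i) → Σ[ n ] f ≡ Σ[ n ] g
Σ-cong zero    eq = refl
Σ-cong (suc n) eq = cong₂ _+_ (eq zero) (Σ-cong n (λ i → eq (suc i)))

Σ-++ : ∀ n p (f : Fin (n +ℕ p) → ℤ) →
  Σ[ n +ℕ p ] f ≡ Σ[ n ] (λ j → f (j ↑ˡ p)) + Σ[ p ] (λ k → f (n ↑ʳ k))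
Σ-++ zero    p f = sym (+-identityˡ _)
Σ-++ (suc n) p f = trans (cong (_+_ (f zero)) (Σ-++ n p (λ i → f (suc i))))
                         (sym (+-assoc (f zero) _ _))

Σ-combine : ∀ m n (f : Fin (m *ℕ n) → ℤ) →
  Σ[ m *ℕ n ] f ≡ Σ[ m ] (λ k → Σ[ n ] (λ j → f (combine k j)))
Σ-combine zero    n f = refl
Σ-combine (suc m) n f = trans (Σ-++ n (m *ℕ n) f)
  (cong (_+_ (Σ[ n ] (λ j → f (j ↑ˡ (m *ℕ n))))) (Σ-combine m n (λ a → f (n ↑ʳ a))))

Σ-*ˡ : ∀ n c (f : Fin n → ℤ) → Σ[ n ] (λ i → c * f i) ≡ c * Σ[ n ] f
Σ-*ˡ zero    c f = sym (*-zeroʳ c)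
Σ-*ˡ (suc n) c f = trans (cong (_+_ (c * f zero)) (Σ-*ˡ n c (λ i → f (suc i))))
                         (sym (*-distribˡ-+ c (f zero) _))

Σ-*ʳ : ∀ n c (f : Fin n → ℤ) → Σ[ n ] (λ i → f i * c) ≡ Σ[ n ] f * c
Σ-*ʳ n c f = begin
  Σ[ n ] (λ i → f i * c) ≡⟨ Σ-cong n (λ i → *-comm (f i) c) ⟩
  Σ[ n ] (λ i → c * f i) ≡⟨ Σ-*ˡ n c f ⟩
  c * Σ[ n ] f           ≡⟨ *-comm c _ ⟩
  Σ[ n ] f * c           ∎

Σ-ones : ∀ n → Σ[ n ] (λ _ → + 1) ≡ + n
Σ-ones zero    = refl
Σ-ones (suc n) = cong (_+_ (+ 1)) (Σ-ones n)

_·_ : ∀ {n} → Row n → Row n → ℤ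
_·_ {n} u v = Σ[ n ] (λ k → u k * v k)

length-nonzero : ∀ {n} → Fin n → + n ≢ + 0
length-nonzero {suc n} _ ()

zero-factorˡ : ∀ x {y} → y ≢ + 0 → x * y ≡ + 0 → x ≡ + 0
zero-factorˡ x y≢0 xy≡0 with i*j≡0⇒i≡0∨j≡0 x xy≡0
... | inj₁ x≡0 = x≡0
... | inj₂ y≡0 = ⊥-elim (y≢0 y≡0)

zero-factorʳ : ∀ {x} y → x ≢ + 0 → x * y ≡ + 0 → y ≡ + 0
zero-factorʳ {x} y x≢0 xy≡0 = zero-factorˡ y x≢0 (trans (*-comm y x) xy≡0)

Sign : ℤ → Set
Sign x = (x ≡ + 1) ⊎ (x ≡ -[1+ 0 ])

sign-square : ∀ {x} → Sign x → x * x ≡ + 1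
sign-square (inj₁ refl) = refl
sign-square (inj₂ refl) = refl

sign-cancelʳ : ∀ a b {x} → Sign x → a * x ≡ b * x → a ≡ b
sign-cancelʳ a b (inj₁ refl) = *-cancelʳ-≡ a b (+ 1)
sign-cancelʳ a b (inj₂ refl) = *-cancelʳ-≡ a b -[1+ 0 ]

sign-cancelˡ : ∀ a b {x} → Sign x → x * a ≡ x * b → a ≡ b
sign-cancelˡ a b (inj₁ refl) = *-cancelˡ-≡ (+ 1) a b
sign-cancelˡ a b (inj₂ refl) = *-cancelˡ-≡ -[1+ 0 ] a b

row-self-inner : ∀ {n} (M : Mat n) → PM M → ∀ i → M i · M i ≡ + n
row-self-inner {n} M pm i = trans (Σ-cong n (λ j → sign-square (pm i j))) (Σ-ones n)

interchange : ∀ a b c d → (a * b) * (c * d) ≡ (a * c) * (b * d)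
interchange a b c d = begin
  (a * b) * (c * d) ≡⟨ *-assoc a b (c * d) ⟩
  a * (b * (c * d)) ≡⟨ cong (a *_) (sym (*-assoc b c d)) ⟩
  a * ((b * c) * d) ≡⟨ cong (λ z → a * (z * d)) (*-comm b c) ⟩
  a * ((c * b) * d) ≡⟨ cong (a *_) (*-assoc c b d) ⟩
  a * (c * (b * d)) ≡⟨ sym (*-assoc a c (b * d)) ⟩
  (a * c) * (b * d) ∎

mul-by-oneʳ : ∀ x {y} → y ≡ + 1 → x * y ≡ x
mul-by-oneʳ x refl = *-identityʳ x

mul-by-oneˡ : ∀ {x} y → x ≡ + 1 → x * y ≡ y
mul-by-oneˡ y refl = *-identityˡ y

Closed : ∀ {n} → Mat n → Set
Closed {n} M = ∀ (u v : Row n) → u ∈R M → v ∈R M → (u ∘ₕ v) ∈R M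

self-inverse : ∀ {n} (M : Mat n) → PM M → ∀ (u : Row n) → u ∈R M → ∀ k → u k * u k ≡ + 1
self-inverse M pm u (i , u≈Mi) k rewrite u≈Mi k = sign-square (pm i k)

egc-from-closure : ∀ {n} (M : Mat n) → PM M → (i₀ : Fin n) → (∀ j → M i₀ j ≡ + 1) →
  Closed M → EGC M
egc-from-closure M pm i₀ ones closed = record
  { closed   = closed
  ; assoc    = λ u v w _ _ _ k → *-assoc (u k) (v k) (w k)
  ; comm     = λ u v _ _ k → *-comm (u k) (v k)
  ; e        = M i₀
  ; e∈R      = i₀ , (λ _ → refl)
  ; identity = λ u _ → (λ k → mul-by-oneˡ (u k) (ones k))
                     , (λ k → mul-by-oneʳ (u k) (ones k))
  ; inverse  = λ u u∈R → u , u∈R , unit u u∈R , unit u u∈R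
  }
  where
  unit : ∀ u → u ∈R M → ∀ k → u k * u k ≡ M i₀ k
  unit u u∈R k = trans (self-inverse M pm u u∈R k) (sym (ones k))

module Tensor {r t : ℕ} (B : Mat r) (C : Mat t) where

  H : Mat (r *ℕ t)
  H = B ⊗ C

  entry-column : ∀ a l j → H a (combine l j) ≡ B (quotient t a) l * C (remainder {r} t a) j
  entry-column a l j =
    cong (λ q → B (quotient t a) (proj₁ q) * C (remainder {r} t a) (proj₂ q))
         (remQuot-combine l j)

  entry : ∀ k i l j → H (combine k i) (combine l j) ≡ B k l * C i j
  entry k i l j = trans (entry-column (combine k i) l j)
    (cong (λ p → B (proj₁ p) l * C (proj₂ p) j) (remQuot-combine k i))

  row-product : ∀ k i k' i' l j →
    H (combine k i) (combine l j) * H (combine k' i') (combine l j)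
      ≡ (B k l * B k' l) * (C i j * C i' j)
  row-product k i k' i' l j =
    trans (cong₂ _*_ (entry k i l j) (entry k' i' l j))
          (interchange (B k l) (C i j) (B k' l) (C i' j))

  inner : ∀ k i k' i' → H (combine k i) · H (combine k' i') ≡ (B k · B k') * (C i · C i')
  inner k i k' i' = begin
    H (combine k i) · H (combine k' i')
      ≡⟨ Σ-combine r t _ ⟩
    Σ[ r ] (λ l → Σ[ t ] (λ j → H (combine k i) (combine l j) * H (combine k' i') (combine l j)))
      ≡⟨ Σ-cong r (λ l → Σ-cong t (row-product k i k' i' l)) ⟩
    Σ[ r ] (λ l → Σ[ t ] (λ j → (B k l * B k' l) * (C i j * C i' j)))
      ≡⟨ Σ-cong r (λ l → Σ-*ˡ t (B k l * B k' l) (λ j → C i j * C i' j)) ⟩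
    Σ[ r ] (λ l → (B k l * B k' l) * (C i · C i'))
      ≡⟨ Σ-*ʳ r (C i · C i') (λ l → B k l * B k' l) ⟩
    (B k · B k') * (C i · C i') ∎

  orthogonalˡ : Fin t → PM C → HHᵀ-diagonal H → HHᵀ-diagonal B
  orthogonalˡ i₀ pC oH k k' k≢k' = zero-factorˡ (B k · B k') Cᵢ₀·Cᵢ₀≢0 (begin
    (B k · B k') * (C i₀ · C i₀)        ≡⟨ sym (inner k i₀ k' i₀) ⟩
    H (combine k i₀) · H (combine k' i₀) ≡⟨ oH _ _ (λ eq → k≢k' (combine-injectiveˡ k i₀ k' i₀ eq)) ⟩
    + 0                                 ∎)
    where
    Cᵢ₀·Cᵢ₀≢0 : C i₀ · C i₀ ≢ + 0
    Cᵢ₀·Cᵢ₀≢0 eq = length-nonzero i₀ (trans (sym (row-self-inner C pC i₀)) eq)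

  orthogonalʳ : Fin r → PM B → HHᵀ-diagonal H → HHᵀ-diagonal C
  orthogonalʳ k₀ pB oH i i' i≢i' = zero-factorʳ (C i · C i') Bₖ₀·Bₖ₀≢0 (begin
    (B k₀ · B k₀) * (C i · C i')        ≡⟨ sym (inner k₀ i k₀ i') ⟩
    H (combine k₀ i) · H (combine k₀ i') ≡⟨ oH _ _ (λ eq → i≢i' (combine-injectiveʳ k₀ i k₀ i' eq)) ⟩
    + 0                                 ∎)
    where
    Bₖ₀·Bₖ₀≢0 : B k₀ · B k₀ ≢ + 0
    Bₖ₀·Bₖ₀≢0 eq = length-nonzero k₀ (trans (sym (row-self-inner B pB k₀)) eq)

  -- Symmetry descends: cancel the ±1 diagonal entry of the other factor

  symmetricˡ : Fin t → PM C → Symmetric H → Symmetric B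
  symmetricˡ i₀ pC sH k l = sign-cancelʳ (B k l) (B l k) (pC i₀ i₀)
    (trans (sym (entry k i₀ l i₀)) (trans (sH _ _) (entry l i₀ k i₀)))

  symmetricʳ : Fin r → PM B → Symmetric H → Symmetric C
  symmetricʳ k₀ pB sH i j = sign-cancelˡ (C i j) (C j i) (pB k₀ k₀)
    (trans (sym (entry k₀ i k₀ j)) (trans (sH _ _) (entry k₀ j k₀ i)))

  closedˡ : (j₀ : Fin t) → (∀ i → C i j₀ ≡ + 1) → Closed H → Closed B
  closedˡ j₀ ones closedH u v (k , u≈) (k' , v≈)
    with closedH _ _ (combine k j₀ , λ _ → refl) (combine k' j₀ , λ _ → refl)
  ... | a , w≈ = quotient t a , λ l → begin
    u l * v l                                             ≡⟨ cong₂ _*_ (u≈ l) (v≈ l) ⟩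
    B k l * B k' l                                        ≡⟨ sym (mul-by-oneʳ _ (cong₂ _*_ (ones j₀) (ones j₀))) ⟩
    (B k l * B k' l) * (C j₀ j₀ * C j₀ j₀)                ≡⟨ sym (row-product k j₀ k' j₀ l j₀) ⟩
    H (combine k j₀) (combine l j₀) * H (combine k' j₀) (combine l j₀) ≡⟨ w≈ (combine l j₀) ⟩
    H a (combine l j₀)                                    ≡⟨ entry-column a l j₀ ⟩
    B (quotient t a) l * C (remainder {r} t a) j₀         ≡⟨ mul-by-oneʳ _ (ones _) ⟩
    B (quotient t a) l                                    ∎

  closedʳ : (l₀ : Fin r) → (∀ k → B k l₀ ≡ + 1) → Closed H → Closed C
  closedʳ l₀ ones closedH u v (i , u≈) (i' , v≈)
    with closedH _ _ (combine l₀ i , λ _ → refl) (combine l₀ i' , λ _ → refl)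
  ... | a , w≈ = remainder {r} t a , λ j → begin
    u j * v j                                             ≡⟨ cong₂ _*_ (u≈ j) (v≈ j) ⟩
    C i j * C i' j                                        ≡⟨ sym (mul-by-oneˡ _ (cong₂ _*_ (ones l₀) (ones l₀))) ⟩
    (B l₀ l₀ * B l₀ l₀) * (C i j * C i' j)                ≡⟨ sym (row-product l₀ i l₀ i' l₀ j) ⟩
    H (combine l₀ i) (combine l₀ j) * H (combine l₀ i') (combine l₀ j) ≡⟨ w≈ (combine l₀ j) ⟩
    H a (combine l₀ j)                                    ≡⟨ entry-column a l₀ j ⟩
    B (quotient t a) l₀ * C (remainder {r} t a) j         ≡⟨ mul-by-oneˡ _ (ones _) ⟩
    C (remainder {r} t a) j                               ∎

first-row-ones : ∀ {n} {M : Mat (suc n)} → Normalised M → ∀ j → M zero j ≡ + 1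
first-row-ones nM j = proj₁ (nM zero j) refl

first-column-ones : ∀ {n} {M : Mat (suc n)} → Normalised M → ∀ i → M i zero ≡ + 1
first-column-ones nM i = proj₂ (nM i zero) refl

-- C is the top-left t×t block of B ⊗ C scaled by B 0 0; if that is +1, C inherits normalisation
normalisedʳ : ∀ {r t} (B : Mat (suc r)) (C : Mat t) → B zero zero ≡ + 1 →
  Normalised (B ⊗ C) → Normalised C
normalisedʳ {r} {t} B C B₀₀≡1 nH i j =
    (λ i≡0 → block-entry (proj₁ (nH (top i) (top j)) (trans (toℕ-↑ˡ i _) i≡0)))
  , (λ j≡0 → block-entry (proj₂ (nH (top i) (top j)) (trans (toℕ-↑ˡ j _) j≡0)))
  where
  open Tensor B C using (entry)
  -- the indices of the top-left block; toℕ (top i) ≡ toℕ i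
  top : Fin t → Fin (suc r *ℕ t)
  top = combine {suc r} zero
  block-entry : (B ⊗ C) (top i) (top j) ≡ + 1 → C i j ≡ + 1
  block-entry eq = trans (sym (mul-by-oneˡ (C i j) B₀₀≡1)) (trans (sym (entry zero i zero j)) eq)

mainTheorem3 : ∀ (r t : ℕ) → 1 ≤ r → 1 ≤ t → (B : Mat r) (C : Mat t) →
    PM B → PM C → Hadamard (B ⊗ C) →
    (Hadamard B × Hadamard C)
    × (Symmetric (B ⊗ C) → Symmetric B × Symmetric C)
    × (Normalised (B ⊗ C) → Normalised B → EGC (B ⊗ C) →
    EGC B × EGC C × Normalised C)
mainTheorem3 (suc r) (suc t) _ _ B C pB pC (_ , oH) =
    ((pB , orthogonalˡ zero pC oH) , (pC , orthogonalʳ zero pB oH))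
  , (λ sH → symmetricˡ zero pC sH , symmetricʳ zero pB sH)
  , λ nH nB eH →
      let nC = normalisedʳ B C (first-row-ones nB zero) nH
      in egc-from-closure B pB zero (first-row-ones nB)
           (closedˡ zero (first-column-ones nC) (EGC.closed eH))
       , egc-from-closure C pC zero (first-row-ones nC)
           (closedʳ zero (first-column-ones nB) (EGC.closed eH))
       , nC
  where
  open Tensor B C
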